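{- For every nonnegative integer $k$, the number of interval graphs on $3k$ vertices satisfies $i_{3k} \ge k!/3^{3k}$.
   Context: A finite undirected simple graph is an interval graph if there is a one-to-one correspondence between its vertices and a set of intervals of the real line such that two distinct vertices are adjacent if and only if their corresponding intervals have non-empty intersection. For each integer $n\ge 0$, $i_n$ denotes the number of isomorphism classes of interval graphs with exactly $n$ vertices. -}

module Defs where

open import Data.Nat using (ℕ)
open import Data.Bool using (Bool; true; false)
open import Data.Fin using (Fin)
open import Data.Product using (Σ; _×_; proj₁; proj₂)
open import Data.Rational using (ℚ; _≤_)
open import Relation.Binary.PropositionalEquality using (_≡_; _≢_)
open import Relation.Nullary using (¬_)
open import Function.Bundles using (_↔_; Inverse; _⇔_)
open import Function.Definitions using (Injective)

record SimpleGraph (n : ℕ) : Set where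
  field
    adj    : Fin n → Fin n → Bool
    sym    : ∀ u v → adj u v ≡ adj v u
    irrefl : ∀ v → adj v v ≡ false

open SimpleGraph public

record Interval : Set where
  constructor [_,_]
  field
    lo : ℚ
    hi : ℚ

open Interval public

Meets : Interval → Interval → Set
Meets I J = (lo I ≤ hi J) × (lo J ≤ hi I)

IsIntervalGraph : {n : ℕ} → SimpleGraph n → Set
IsIntervalGraph {n} G =
  Σ (Fin n → Interval) λ I →
    (∀ v → lo (I v) ≤ hi (I v)) ×
    Injective _≡_ _≡_ I ×
    (∀ u v → u ≢ v → (adj G u v ≡ true ⇔ Meets (I u) (I v)))

_≅_ : {n : ℕ} → SimpleGraph n → SimpleGraph n → Set
_≅_ {n} G H =
  Σ (Fin n ↔ Fin n) λ σ →
    ∀ u v → adj G u v ≡ adj H (Inverse.to σ u) (Inverse.to σ v)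

-- "i_n ≥ m": there are m pairwise non-isomorphic interval graphs on n vertices,
-- i.e. at least m isomorphism classes of interval graphs with n vertices.
AtLeastIntervalClasses : ℕ → ℕ → Set
AtLeastIntervalClasses n m =
  Σ (Fin m → SimpleGraph n) λ G →
    (∀ i → IsIntervalGraph (G i)) ×
    (∀ i j → G i ≅ G j → i ≡ j)

-- Take k points P t = {k+1+t}, k nested intervals Q s = [0, s] and, for a map
-- c : Fin k → Fin k, k bridges B j = [c j, k+j]: B j meets P t iff t < j, meets Q s iff c j ≤ s,
-- and all bridges meet each other. If c 0 = 0, the P t are exactly the vertices of degree < k and
-- their degrees are pairwise distinct, so an isomorphism between two such graphs fixes every P t.
-- It then fixes every B (1+j), the only neighbour of P j that is not a neighbour of P (1+j), and
-- the degree j + (k-1) + (k - c j) of B j recovers c j. So the k^(k-1) maps c with c 0 = 0 give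
-- pairwise non-isomorphic interval graphs on 3k vertices, and k! ≤ k^k ≤ 27^k k^(k-1).

module Submission where

open import Defs hiding (sym)
open import Data.Bool using (Bool; true; false; not; _∧_; if_then_else_)
open import Data.Bool.Properties using (∧-comm; ∧-identityʳ)
open import Data.Empty using (⊥-elim)
open import Data.Fin using (Fin; zero; suc; toℕ; inject₁; _↑ˡ_; _↑ʳ_; _≟_; funToFin; finToFun; combine)
open import Data.Fin.Properties using (toℕ-injective; toℕ<n; toℕ-inject₁; funToFin-finToFin)
import Data.Fin.Properties as Fin
import Data.Integer as ℤ
import Data.Integer.Properties as ℤ
open import Data.Nat using (ℕ; zero; suc; _+_; _*_; _∸_; _^_; _!; _≤_; _<_; _≤ᵇ_; _<ᵇ_; _≤?_; z≤n; s≤s; z<s)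
open import Data.Nat.Divisibility using (∣1⇒≡1)
open import Data.Nat.Properties hiding (_≟_)
open import Algebra.Properties.CommutativeMonoid.Sum +-0-commutativeMonoid using (sum; sum-permute)
open import Data.Product using (∃-syntax; _×_; _,_; proj₁; proj₂)
open import Data.Rational using (ℚ; mkℚ; *≤*) renaming (_≤_ to _≤ℚ_)
open import Data.Vec.Functional using (_++_; []; _∷_)
open import Data.Vec.Functional.Properties using (lookup-++ˡ; lookup-++ʳ)
open import Function using (_∘_; _⇔_; _↔_; mk⇔; Inverse; Injective)
open import Relation.Binary.PropositionalEquality using (_≡_; _≢_; refl; sym; trans; cong; cong₂; subst; subst₂; module ≡-Reasoning)
open import Relation.Nullary using (Dec; yes; no; does; ¬_; _×-dec_)
open import Relation.Nullary.Decidable using (dec-true; dec-false; does-⇔)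

n<3^n : ∀ n → n < 3 ^ n
n<3^n zero    = z<s
n<3^n (suc n) = begin-strict
  suc n          ≤⟨ n<3^n n ⟩
  3 ^ n          <⟨ m<m+n (3 ^ n) (m^n>0 3 n) ⟩
  3 ^ n + 3 ^ n  ≤⟨ +-monoʳ-≤ (3 ^ n) (m≤m+n (3 ^ n) (3 ^ n + 0)) ⟩
  3 ^ suc n      ∎
  where open ≤-Reasoning

n!≤n^n : ∀ n → n ! ≤ n ^ n
n!≤n^n zero    = ≤-refl
n!≤n^n (suc n) = *-monoʳ-≤ (suc n) (≤-trans (n!≤n^n n) (^-monoˡ-≤ n (n≤1+n n)))

factorial-bound : ∀ n → suc n ! ≤ 3 ^ (3 * suc n) * suc n ^ n
factorial-bound n = *-mono-≤ (≤-trans (<⇒≤ (n<3^n (suc n))) (^-monoʳ-≤ 3 (m≤m+n (suc n) _)))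
                             (≤-trans (n!≤n^n n) (^-monoˡ-≤ n (n≤1+n n)))

does-true⁻¹ : ∀ {a} {A : Set a} (a? : Dec A) → does a? ≡ true → A
does-true⁻¹ (yes a) _ = a

does-false⁻¹ : ∀ {a} {A : Set a} (a? : Dec A) → does a? ≡ false → ¬ A
does-false⁻¹ (no ¬a) _ = ¬a

-- `does (m ≤? n)` computes to `m ≤ᵇ n`, so facts about the decision procedure apply to `_≤ᵇ_`.
≤ᵇ-true : ∀ {m n} → m ≤ n → (m ≤ᵇ n) ≡ true
≤ᵇ-true = dec-true (_ ≤? _)

≤ᵇ-false : ∀ {m n} → n < m → (m ≤ᵇ n) ≡ false
≤ᵇ-false n<m = dec-false (_ ≤? _) (<⇒≱ n<m)

≤ᵇ-true⁻¹ : ∀ {m n} → (m ≤ᵇ n) ≡ true → m ≤ n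
≤ᵇ-true⁻¹ = does-true⁻¹ (_ ≤? _)

≤ᵇ-false⁻¹ : ∀ {m n} → (m ≤ᵇ n) ≡ false → n < m
≤ᵇ-false⁻¹ = ≰⇒> ∘ does-false⁻¹ (_ ≤? _)

∧-true : ∀ {x y} → x ∧ y ≡ true → x ≡ true × y ≡ true
∧-true {true} {true} _ = refl , refl

+-cancelˡ-≤ᵇ : ∀ k m n → (k + m ≤ᵇ k + n) ≡ (m ≤ᵇ n)
+-cancelˡ-≤ᵇ k m n = does-⇔ (mk⇔ (+-cancelˡ-≤ k m n) (+-monoʳ-≤ k)) (_ ≤? _) (_ ≤? _)

toℕ-≤ᵇ-antisym : ∀ {n} (i j : Fin n) → (toℕ i ≤ᵇ toℕ j) ∧ (toℕ j ≤ᵇ toℕ i) ≡ does (i ≟ j)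
toℕ-≤ᵇ-antisym i j = does-⇔ (mk⇔ (λ (i≤j , j≤i) → toℕ-injective (≤-antisym i≤j j≤i))
                                 (λ { refl → ≤-refl , ≤-refl }))
                            ((toℕ i ≤? toℕ j) ×-dec (toℕ j ≤? toℕ i)) (i ≟ j)

-- Counting

indicator : Bool → ℕ
indicator b = if b then 1 else 0

count : ∀ {n} → (Fin n → Bool) → ℕ
count {zero}  p = 0
count {suc n} p = indicator (p zero) + count (p ∘ suc)

count≡sum : ∀ {n} (p : Fin n → Bool) → count p ≡ sum (indicator ∘ p)
count≡sum {zero}  p = refl
count≡sum {suc n} p = cong (indicator (p zero) +_) (count≡sum (p ∘ suc))

count-cong : ∀ {n} {p q : Fin n → Bool} → (∀ i → p i ≡ q i) → count p ≡ count q
count-cong {zero}  p≗q = refl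
count-cong {suc n} p≗q = cong₂ _+_ (cong indicator (p≗q zero)) (count-cong (p≗q ∘ suc))

count-none : ∀ {n} (p : Fin n → Bool) → (∀ i → p i ≡ false) → count p ≡ 0
count-none {zero}  p _    = refl
count-none {suc n} p none rewrite none zero = count-none (p ∘ suc) (none ∘ suc)

count-pos : ∀ {n} (p : Fin n → Bool) i → p i ≡ true → 1 ≤ count p
count-pos p zero    pi rewrite pi = s≤s z≤n
count-pos p (suc i) pi = ≤-trans (count-pos (p ∘ suc) i pi) (m≤n+m _ _)

count-≤ᵇ : ∀ n m → count (λ (j : Fin n) → m ≤ᵇ toℕ j) ≡ n ∸ m
count-≤ᵇ zero    m       = sym (0∸n≡0 m)
count-≤ᵇ (suc n) zero    = cong suc (count-≤ᵇ n zero)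
count-≤ᵇ (suc n) (suc m) = trans (count-cong (λ (j : Fin n) → +-cancelˡ-≤ᵇ 1 m (toℕ j))) (count-≤ᵇ n m)

count-true : ∀ n → count (λ (_ : Fin n) → true) ≡ n
count-true n = count-≤ᵇ n 0

count-<ᵇ : ∀ {n m} → m ≤ n → count (λ (j : Fin n) → toℕ j <ᵇ m) ≡ m
count-<ᵇ {zero}          z≤n       = refl
count-<ᵇ {suc n} {zero}  _         = count-none (λ (j : Fin n) → toℕ j <ᵇ 0) (λ _ → refl)
count-<ᵇ {suc n} {suc m} (s≤s m≤n) = cong suc (count-<ᵇ m≤n)

count-≟ : ∀ {n} (u : Fin n) → count (λ v → does (u ≟ v)) ≡ 1
count-≟ {suc n} zero = cong suc (count-none (λ (v : Fin n) → does (zero ≟ suc v)) (λ _ → refl))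
count-≟ (suc u)      = count-≟ u

count-remove : ∀ {n} (p : Fin n → Bool) u → p u ≡ true →
               suc (count (λ v → not (does (u ≟ v)) ∧ p v)) ≡ count p
count-remove p zero    pu rewrite pu = refl
count-remove p (suc u) pu =
  trans (sym (+-suc (indicator (p zero)) _)) (cong (indicator (p zero) +_) (count-remove (p ∘ suc) u pu))

count-split : ∀ m {n} (p : Fin (m + n) → Bool) →
              count p ≡ count (p ∘ (_↑ˡ n)) + count (p ∘ (m ↑ʳ_))
count-split zero    p = refl
count-split (suc m) p =
  trans (cong (indicator (p zero) +_) (count-split m (p ∘ suc))) (sym (+-assoc (indicator (p zero)) _ _))

count-permute : ∀ {n} (p : Fin n → Bool) (π : Fin n ↔ Fin n) → count p ≡ count (p ∘ Inverse.to π)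
count-permute p π = begin
  count p                             ≡⟨ count≡sum p ⟩
  sum (indicator ∘ p)                 ≡⟨ sum-permute (indicator ∘ p) π ⟩
  sum (indicator ∘ p ∘ Inverse.to π)  ≡⟨ count≡sum (p ∘ Inverse.to π) ⟨
  count (p ∘ Inverse.to π)            ∎
  where open ≡-Reasoning

degree : ∀ {n} → SimpleGraph n → Fin n → ℕ
degree G u = count (adj G u)

degree-≅ : ∀ {n} {G H : SimpleGraph n} (iso : G ≅ H) u → degree H (Inverse.to (proj₁ iso) u) ≡ degree G u
degree-≅ {H = H} (σ , σ-adj) u =
  trans (count-permute (adj H (Inverse.to σ u)) σ) (count-cong (λ v → sym (σ-adj u v)))

-- Interval graphs with natural endpoints

toℚ : ℕ → ℚ
toℚ n = mkℚ (ℤ.+ n) 0 (λ (_ , i∣1) → ∣1⇒≡1 i∣1)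

toℚ-mono-≤ : ∀ {m n} → m ≤ n → toℚ m ≤ℚ toℚ n
toℚ-mono-≤ {m} {n} m≤n =
  *≤* (subst₂ ℤ._≤_ (sym (ℤ.*-identityʳ (ℤ.+ m))) (sym (ℤ.*-identityʳ (ℤ.+ n))) (ℤ.+≤+ m≤n))

toℚ-cancel-≤ : ∀ {m n} → toℚ m ≤ℚ toℚ n → m ≤ n
toℚ-cancel-≤ {m} {n} (*≤* m≤n) =
  ℤ.drop‿+≤+ (subst₂ ℤ._≤_ (ℤ.*-identityʳ (ℤ.+ m)) (ℤ.*-identityʳ (ℤ.+ n)) m≤n)

toℚ-injective : ∀ {m n} → toℚ m ≡ toℚ n → m ≡ n
toℚ-injective = cong (ℤ.∣_∣ ∘ ℚ.numerator)

meetsᵇ : ℕ × ℕ → ℕ × ℕ → Bool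
meetsᵇ (a , b) (c , d) = (a ≤ᵇ d) ∧ (c ≤ᵇ b)

meetsᵇ-comm : ∀ I J → meetsᵇ I J ≡ meetsᵇ J I
meetsᵇ-comm (a , b) (c , d) = ∧-comm (a ≤ᵇ d) (c ≤ᵇ b)

toInterval : ℕ × ℕ → Interval
toInterval (a , b) = [ toℚ a , toℚ b ]

toInterval-injective : ∀ {I J} → toInterval I ≡ toInterval J → I ≡ J
toInterval-injective e = cong₂ _,_ (toℚ-injective (cong lo e)) (toℚ-injective (cong hi e))

meetsᵇ⇔Meets : ∀ I J → meetsᵇ I J ≡ true ⇔ Meets (toInterval I) (toInterval J)
meetsᵇ⇔Meets (a , b) (c , d) = mk⇔
  (λ e → let (a≤d , c≤b) = ∧-true e in toℚ-mono-≤ (≤ᵇ-true⁻¹ a≤d) , toℚ-mono-≤ (≤ᵇ-true⁻¹ c≤b))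
  (λ (a≤d , c≤b) → cong₂ _∧_ (≤ᵇ-true (toℚ-cancel-≤ a≤d)) (≤ᵇ-true (toℚ-cancel-≤ c≤b)))

module _ {n} (ι : Fin n → ℕ × ℕ) where

  intervalGraph : SimpleGraph n
  intervalGraph = record
    { adj    = λ u v → not (does (u ≟ v)) ∧ meetsᵇ (ι u) (ι v)
    ; sym    = λ u v → cong₂ (λ x y → not x ∧ y) (does-⇔ (mk⇔ sym sym) (u ≟ v) (v ≟ u))
                                                  (meetsᵇ-comm (ι u) (ι v))
    ; irrefl = λ v → cong (λ x → not x ∧ meetsᵇ (ι v) (ι v)) (dec-true (v ≟ v) refl)
    }

  intervalGraph-adj : ∀ {u v} → u ≢ v → adj intervalGraph u v ≡ meetsᵇ (ι u) (ι v)
  intervalGraph-adj {u} {v} u≢v = cong (λ x → not x ∧ meetsᵇ (ι u) (ι v)) (dec-false (u ≟ v) u≢v)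

  intervalGraph-adj⇒≢ : ∀ {u v} → adj intervalGraph u v ≡ true → u ≢ v
  intervalGraph-adj⇒≢ {u} e refl with () ← trans (sym e) (irrefl intervalGraph u)

  intervalGraph-adj⇒meets : ∀ {u v} → adj intervalGraph u v ≡ true → meetsᵇ (ι u) (ι v) ≡ true
  intervalGraph-adj⇒meets {u} {v} = proj₂ ∘ ∧-true {not (does (u ≟ v))}

  intervalGraph-isInterval : (∀ v → proj₁ (ι v) ≤ proj₂ (ι v)) → Injective _≡_ _≡_ ι →
                             IsIntervalGraph intervalGraph
  intervalGraph-isInterval proper ι-injective =
    toInterval ∘ ι , toℚ-mono-≤ ∘ proper , ι-injective ∘ toInterval-injective , adj⇔meets
    where
    adj⇔meets : ∀ u v → u ≢ v → adj intervalGraph u v ≡ true ⇔ Meets (toInterval (ι u)) (toInterval (ι v))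
    adj⇔meets u v u≢v = subst (λ b → b ≡ true ⇔ _) (sym (intervalGraph-adj u≢v)) (meetsᵇ⇔Meets (ι u) (ι v))

  meetCount : Fin n → ℕ
  meetCount u = count (λ v → meetsᵇ (ι u) (ι v))

  suc-degree-intervalGraph : ∀ u → proj₁ (ι u) ≤ proj₂ (ι u) → suc (degree intervalGraph u) ≡ meetCount u
  suc-degree-intervalGraph u lo≤hi =
    count-remove (λ v → meetsᵇ (ι u) (ι v)) u (cong₂ _∧_ (≤ᵇ-true lo≤hi) (≤ᵇ-true lo≤hi))

-- The family of graphs

data SplitView (m : ℕ) {n : ℕ} : Fin (m + n) → Set where
  left  : ∀ i → SplitView m (i ↑ˡ n)
  right : ∀ j → SplitView m (m ↑ʳ j)

splitView : ∀ m {n} (i : Fin (m + n)) → SplitView m i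
splitView zero    j       = right j
splitView (suc m) zero    = left zero
splitView (suc m) (suc i) with splitView m i
... | left i  = left (suc i)
... | right j = right j

↑ˡ≢↑ʳ : ∀ {m n} (i : Fin m) (j : Fin n) → i ↑ˡ n ≢ m ↑ʳ j
↑ˡ≢↑ʳ zero    j ()
↑ˡ≢↑ʳ (suc i) j e = ↑ˡ≢↑ʳ i j (Fin.suc-injective e)

module _ {k : ℕ} where

  vP vB vQ : Fin k → Fin (3 * k)
  vP t = t ↑ˡ (k + (k + 0))
  vB j = k ↑ʳ (j ↑ˡ (k + 0))
  vQ s = k ↑ʳ (k ↑ʳ (s ↑ˡ 0))

  data Block : Fin (3 * k) → Set where
    inP : ∀ t → Block (vP t)
    inB : ∀ j → Block (vB j)
    inQ : ∀ s → Block (vQ s)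

  block : ∀ v → Block v
  block v with splitView k v
  ... | left t = inP t
  ... | right w with splitView k w
  ...   | left j = inB j
  ...   | right w′ with splitView k w′
  ...     | left s = inQ s
  ...     | right ()

  vB≢vP : ∀ j t → vB j ≢ vP t
  vB≢vP j t = ↑ˡ≢↑ʳ t (j ↑ˡ (k + 0)) ∘ sym

  count-blocks : ∀ (p : Fin (3 * k) → Bool) → count p ≡ count (p ∘ vP) + (count (p ∘ vB) + count (p ∘ vQ))
  count-blocks p = begin
    count p
      ≡⟨ count-split k p ⟩
    count (p ∘ vP) + count (p ∘ (k ↑ʳ_))
      ≡⟨ cong (count (p ∘ vP) +_) (count-split k (p ∘ (k ↑ʳ_))) ⟩
    count (p ∘ vP) + (count (p ∘ vB) + count (p ∘ (k ↑ʳ_) ∘ (k ↑ʳ_)))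
      ≡⟨ cong (λ x → count (p ∘ vP) + (count (p ∘ vB) + x))
              (trans (count-split k (p ∘ (k ↑ʳ_) ∘ (k ↑ʳ_))) (+-identityʳ _)) ⟩
    count (p ∘ vP) + (count (p ∘ vB) + count (p ∘ vQ))
      ∎
    where open ≡-Reasoning

  P : Fin k → ℕ × ℕ
  P t = k + suc (toℕ t) , k + suc (toℕ t)

  B : (Fin k → Fin k) → Fin k → ℕ × ℕ
  B c j = toℕ (c j) , k + toℕ j

  Q : Fin k → ℕ × ℕ
  Q s = 0 , toℕ s

  layout : (Fin k → Fin k) → Fin (3 * k) → ℕ × ℕ
  layout c = P ++ (B c ++ (Q ++ []))

  blockInterval : (Fin k → Fin k) → ∀ {v} → Block v → ℕ × ℕ
  blockInterval c (inP t)  = P t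
  blockInterval c (inB j) = B c j
  blockInterval c (inQ s) = Q s

  layout-block : ∀ c {v} (b : Block v) → layout c v ≡ blockInterval c b
  layout-block c (inP t)  = lookup-++ˡ P _ t
  layout-block c (inB j) = trans (lookup-++ʳ P _ (j ↑ˡ _)) (lookup-++ˡ (B c) _ j)
  layout-block c (inQ s) = trans (lookup-++ʳ P _ _) (trans (lookup-++ʳ (B c) _ _) (lookup-++ˡ Q [] s))

  meets-PP : ∀ t t′ → meetsᵇ (P t) (P t′) ≡ does (t ≟ t′)
  meets-PP t t′ = trans (cong₂ _∧_ (shift (toℕ t) (toℕ t′)) (shift (toℕ t′) (toℕ t))) (toℕ-≤ᵇ-antisym t t′)
    where
    shift : ∀ a b → (k + suc a ≤ᵇ k + suc b) ≡ (a ≤ᵇ b)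
    shift a b = trans (+-cancelˡ-≤ᵇ k (suc a) (suc b)) (+-cancelˡ-≤ᵇ 1 a b)

  meets-PQ : ∀ t s → meetsᵇ (P t) (Q s) ≡ false
  meets-PQ t s = trans (∧-identityʳ _) (≤ᵇ-false (≤-trans (toℕ<n s) (m≤m+n k (suc (toℕ t)))))

  meets-QP : ∀ s t → meetsᵇ (Q s) (P t) ≡ false
  meets-QP s t = trans (meetsᵇ-comm (Q s) (P t)) (meets-PQ t s)

  module _ (c : Fin k → Fin k) where

    c≤k+ : ∀ j x → toℕ (c j) ≤ k + x
    c≤k+ j x = ≤-trans (<⇒≤ (toℕ<n (c j))) (m≤m+n k x)

    meets-PB : ∀ t j → meetsᵇ (P t) (B c j) ≡ (suc (toℕ t) ≤ᵇ toℕ j)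
    meets-PB t j = trans (cong₂ _∧_ (+-cancelˡ-≤ᵇ k (suc (toℕ t)) (toℕ j)) (≤ᵇ-true (c≤k+ j _))) (∧-identityʳ _)

    meets-BP : ∀ j t → meetsᵇ (B c j) (P t) ≡ (suc (toℕ t) ≤ᵇ toℕ j)
    meets-BP j t = trans (meetsᵇ-comm (B c j) (P t)) (meets-PB t j)

    meets-BB : ∀ j j′ → meetsᵇ (B c j) (B c j′) ≡ true
    meets-BB j j′ = cong₂ _∧_ (≤ᵇ-true (c≤k+ j _)) (≤ᵇ-true (c≤k+ j′ _))

    meets-BQ : ∀ j s → meetsᵇ (B c j) (Q s) ≡ (toℕ (c j) ≤ᵇ toℕ s)
    meets-BQ j s = ∧-identityʳ _

    blockInterval-proper : ∀ {v} (b : Block v) → proj₁ (blockInterval c b) ≤ proj₂ (blockInterval c b)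
    blockInterval-proper (inP t)  = ≤-refl
    blockInterval-proper (inB j) = c≤k+ j _
    blockInterval-proper (inQ s) = z≤n

    layout-proper : ∀ v → proj₁ (layout c v) ≤ proj₂ (layout c v)
    layout-proper v =
      subst (λ I → proj₁ I ≤ proj₂ I) (sym (layout-block c (block v))) (blockInterval-proper (block v))

    P≢B : ∀ t j → P t ≢ B c j
    P≢B t j e = <⇒≢ (≤-trans (toℕ<n (c j)) (m≤m+n k _)) (sym (cong proj₁ e))

    P≢Q : ∀ t s → P t ≢ Q s
    P≢Q t s e = m+1+n≢0 k (cong proj₁ e)

    B≢Q : ∀ j s → B c j ≢ Q s
    B≢Q j s e = <⇒≢ (≤-trans (toℕ<n s) (m≤m+n k _)) (sym (cong proj₂ e))

    blockInterval-injective : ∀ {u v} (b : Block u) (b′ : Block v) →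
                              blockInterval c b ≡ blockInterval c b′ → u ≡ v
    blockInterval-injective (inP t) (inP t′) e =
      cong vP (toℕ-injective (suc-injective (+-cancelˡ-≡ k _ _ (cong proj₁ e))))
    blockInterval-injective (inP t) (inB j)  e = ⊥-elim (P≢B t j e)
    blockInterval-injective (inP t) (inQ s)  e = ⊥-elim (P≢Q t s e)
    blockInterval-injective (inB j) (inP t)  e = ⊥-elim (P≢B t j (sym e))
    blockInterval-injective (inB j) (inB j′) e = cong vB (toℕ-injective (+-cancelˡ-≡ k _ _ (cong proj₂ e)))
    blockInterval-injective (inB j) (inQ s)  e = ⊥-elim (B≢Q j s e)
    blockInterval-injective (inQ s) (inP t)  e = ⊥-elim (P≢Q t s (sym e))
    blockInterval-injective (inQ s) (inB j)  e = ⊥-elim (B≢Q j s (sym e))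
    blockInterval-injective (inQ s) (inQ s′) e = cong vQ (toℕ-injective (cong proj₂ e))

    layout-injective : Injective _≡_ _≡_ (layout c)
    layout-injective {u} {v} e = blockInterval-injective (block u) (block v)
      (trans (sym (layout-block c (block u))) (trans e (layout-block c (block v))))

    graph : SimpleGraph (3 * k)
    graph = intervalGraph (layout c)

    graph-isInterval : IsIntervalGraph graph
    graph-isInterval = intervalGraph-isInterval (layout c) layout-proper layout-injective

    meetCount-blocks : ∀ {v} (b : Block v) → let I = blockInterval c b in
      meetCount (layout c) v ≡ count (meetsᵇ I ∘ P) + (count (meetsᵇ I ∘ B c) + count (meetsᵇ I ∘ Q))
    meetCount-blocks b = trans (count-blocks _) (cong₂ _+_ (count-cong (λ t → meets-at (inP t)))
                                                (cong₂ _+_ (count-cong (λ j → meets-at (inB j)))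
                                                           (count-cong (λ s → meets-at (inQ s)))))
      where
      meets-at : ∀ {w} (b′ : Block w) → meetsᵇ (layout c _) (layout c w) ≡ meetsᵇ (blockInterval c b) (blockInterval c b′)
      meets-at b′ = cong₂ meetsᵇ (layout-block c b) (layout-block c b′)

    meetCount-vP : ∀ t → meetCount (layout c) (vP t) ≡ suc (k ∸ suc (toℕ t))
    meetCount-vP t = begin
      meetCount (layout c) (vP t)
        ≡⟨ meetCount-blocks (inP t) ⟩
      count (meetsᵇ (P t) ∘ P) + (count (meetsᵇ (P t) ∘ B c) + count (meetsᵇ (P t) ∘ Q))
        ≡⟨ cong₂ _+_ (trans (count-cong (meets-PP t)) (count-≟ t))
                     (cong₂ _+_ (trans (count-cong (meets-PB t)) (count-≤ᵇ k (suc (toℕ t))))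
                                (count-none (meetsᵇ (P t) ∘ Q) (meets-PQ t))) ⟩
      1 + ((k ∸ suc (toℕ t)) + 0)
        ≡⟨ cong suc (+-identityʳ _) ⟩
      suc (k ∸ suc (toℕ t))
        ∎
      where open ≡-Reasoning

    meetCount-vB : ∀ j → meetCount (layout c) (vB j) ≡ toℕ j + (k + (k ∸ toℕ (c j)))
    meetCount-vB j = begin
      meetCount (layout c) (vB j)
        ≡⟨ meetCount-blocks (inB j) ⟩
      count (meetsᵇ (B c j) ∘ P) + (count (meetsᵇ (B c j) ∘ B c) + count (meetsᵇ (B c j) ∘ Q))
        ≡⟨ cong₂ _+_ (trans (count-cong (meets-BP j)) (count-<ᵇ (<⇒≤ (toℕ<n j))))
                     (cong₂ _+_ (trans (count-cong (meets-BB j)) (count-true k))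
                                (trans (count-cong (meets-BQ j)) (count-≤ᵇ k (toℕ (c j))))) ⟩
      toℕ j + (k + (k ∸ toℕ (c j)))
        ∎
      where open ≡-Reasoning

    meetCount-vQ : ∀ z → toℕ (c z) ≡ 0 → ∀ s → suc k ≤ meetCount (layout c) (vQ s)
    meetCount-vQ z cz s = begin
      1 + k
        ≤⟨ +-mono-≤ (count-pos (meetsᵇ (Q s) ∘ B c) z (cong (_≤ᵇ toℕ s) cz)) (≤-reflexive (sym (count-true k))) ⟩
      count (meetsᵇ (Q s) ∘ B c) + count (meetsᵇ (Q s) ∘ Q)
        ≤⟨ m≤n+m _ (count (meetsᵇ (Q s) ∘ P)) ⟩
      count (meetsᵇ (Q s) ∘ P) + (count (meetsᵇ (Q s) ∘ B c) + count (meetsᵇ (Q s) ∘ Q))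
        ≡⟨ meetCount-blocks (inQ s) ⟨
      meetCount (layout c) (vQ s)
        ∎
      where open ≤-Reasoning

    meetCount≤⇒vP : ∀ z → toℕ (c z) ≡ 0 → ∀ v → meetCount (layout c) v ≤ k → ∃[ t ] v ≡ vP t
    meetCount≤⇒vP z cz v small with block v
    ... | inP t = t , refl
    ... | inB j = ⊥-elim (<⇒≱ (≤-trans (m<m+n k (m<n⇒0<n∸m (toℕ<n (c j)))) (m≤n+m _ (toℕ j)))
                              (subst (_≤ k) (meetCount-vB j) small))
    ... | inQ s = ⊥-elim (<⇒≱ (meetCount-vQ z cz s) small)

    adj-vB-vP : ∀ j t → adj graph (vB j) (vP t) ≡ (suc (toℕ t) ≤ᵇ toℕ j)
    adj-vB-vP j t = begin
      adj graph (vB j) (vP t)                     ≡⟨ intervalGraph-adj (layout c) (vB≢vP j t) ⟩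
      meetsᵇ (layout c (vB j)) (layout c (vP t))  ≡⟨ cong₂ meetsᵇ (layout-block c (inB j)) (layout-block c (inP t)) ⟩
      meetsᵇ (B c j) (P t)                        ≡⟨ meets-BP j t ⟩
      suc (toℕ t) ≤ᵇ toℕ j                        ∎
      where open ≡-Reasoning

    adj-vP⇒vB : ∀ {w} (b : Block w) t → adj graph w (vP t) ≡ true → ∃[ j ] (w ≡ vB j × toℕ t < toℕ j)
    adj-vP⇒vB b t e with trans (sym (cong₂ meetsᵇ (layout-block c b) (layout-block c (inP t))))
                               (intervalGraph-adj⇒meets (layout c) e)
    ... | meets with b
    ...   | inP t′ = ⊥-elim (intervalGraph-adj⇒≢ (layout c) e
                       (cong vP (does-true⁻¹ (t′ ≟ t) (trans (sym (meets-PP t′ t)) meets))))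
    ...   | inB j  = j , refl , ≤ᵇ-true⁻¹ (trans (sym (meets-BP j t)) meets)
    ...   | inQ s  with () ← trans (sym meets) (meets-QP s t)

-- Isomorphisms within the family

module _ {n} {c c′ : Fin (suc n) → Fin (suc n)} (c′₀ : c′ zero ≡ zero) (iso : graph c ≅ graph c′) where

  private
    σ : Fin (3 * suc n) → Fin (3 * suc n)
    σ = Inverse.to (proj₁ iso)

    σ-adj : ∀ u v → adj (graph c′) (σ u) (σ v) ≡ adj (graph c) u v
    σ-adj u v = sym (proj₂ iso u v)

  meetCount-σ : ∀ u → meetCount (layout c′) (σ u) ≡ meetCount (layout c) u
  meetCount-σ u = begin
    meetCount (layout c′) (σ u)    ≡⟨ suc-degree-intervalGraph (layout c′) (σ u) (layout-proper c′ (σ u)) ⟨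
    suc (degree (graph c′) (σ u))  ≡⟨ cong suc (degree-≅ {G = graph c} {H = graph c′} iso u) ⟩
    suc (degree (graph c) u)       ≡⟨ suc-degree-intervalGraph (layout c) u (layout-proper c u) ⟩
    meetCount (layout c) u         ∎
    where open ≡-Reasoning

  σ-fixes-vP : ∀ t → σ (vP t) ≡ vP t
  σ-fixes-vP t = fixed (meetCount≤⇒vP c′ zero (cong toℕ c′₀) (σ (vP t)) small)
    where
    open ≡-Reasoning
    σt-count : meetCount (layout c′) (σ (vP t)) ≡ suc (n ∸ toℕ t)
    σt-count = trans (meetCount-σ (vP t)) (meetCount-vP c t)
    small : meetCount (layout c′) (σ (vP t)) ≤ suc n
    small = ≤-trans (≤-reflexive σt-count) (s≤s (m∸n≤m n (toℕ t)))
    fixed : ∃[ t′ ] σ (vP t) ≡ vP t′ → σ (vP t) ≡ vP t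
    fixed (t′ , σt≡t′) = trans σt≡t′ (cong vP (toℕ-injective
      (∸-cancelˡ-≡ (≤-pred (toℕ<n t′)) (≤-pred (toℕ<n t)) (suc-injective (begin
        suc (n ∸ toℕ t′)                  ≡⟨ meetCount-vP c′ t′ ⟨
        meetCount (layout c′) (vP t′)     ≡⟨ cong (meetCount (layout c′)) σt≡t′ ⟨
        meetCount (layout c′) (σ (vP t))  ≡⟨ σt-count ⟩
        suc (n ∸ toℕ t)                   ∎)))))

  σ-fixes-vB : ∀ j → σ (vB (suc j)) ≡ vB (suc j)
  σ-fixes-vB j = trans σb≡vBi (cong vB (toℕ-injective (≤-antisym i≤1+j 1+j≤i)))
    where
    open ≡-Reasoning
    adj-σb : ∀ t → adj (graph c′) (σ (vB (suc j))) (vP t) ≡ (suc (toℕ t) ≤ᵇ suc (toℕ j))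
    adj-σb t = begin
      adj (graph c′) (σ (vB (suc j))) (vP t)      ≡⟨ cong (adj (graph c′) (σ (vB (suc j)))) (σ-fixes-vP t) ⟨
      adj (graph c′) (σ (vB (suc j))) (σ (vP t))  ≡⟨ σ-adj (vB (suc j)) (vP t) ⟩
      adj (graph c) (vB (suc j)) (vP t)           ≡⟨ adj-vB-vP c (suc j) t ⟩
      suc (toℕ t) ≤ᵇ suc (toℕ j)                  ∎
    neighbour : ∃[ i ] (σ (vB (suc j)) ≡ vB i × toℕ (inject₁ j) < toℕ i)
    neighbour = adj-vP⇒vB c′ (block _) (inject₁ j)
      (trans (adj-σb (inject₁ j)) (≤ᵇ-true (s≤s (≤-reflexive (toℕ-inject₁ j)))))
    i = proj₁ neighbour
    σb≡vBi = proj₁ (proj₂ neighbour)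
    1+j≤i : suc (toℕ j) ≤ toℕ i
    1+j≤i = subst (λ x → suc x ≤ toℕ i) (toℕ-inject₁ j) (proj₂ (proj₂ neighbour))
    i≤1+j : toℕ i ≤ suc (toℕ j)
    i≤1+j = ≤-pred (≤ᵇ-false⁻¹ (begin
      suc (suc (toℕ j)) ≤ᵇ toℕ i                    ≡⟨ adj-vB-vP c′ i (suc j) ⟨
      adj (graph c′) (vB i) (vP (suc j))            ≡⟨ cong (λ w → adj (graph c′) w (vP (suc j))) σb≡vBi ⟨
      adj (graph c′) (σ (vB (suc j))) (vP (suc j))  ≡⟨ adj-σb (suc j) ⟩
      suc (suc (toℕ j)) ≤ᵇ suc (toℕ j)              ≡⟨ ≤ᵇ-false {suc (suc (toℕ j))} ≤-refl ⟩
      false                                         ∎))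

  ≅⇒tails-agree : ∀ j → c (suc j) ≡ c′ (suc j)
  ≅⇒tails-agree j = toℕ-injective (∸-cancelˡ-≡ (<⇒≤ (toℕ<n (c (suc j)))) (<⇒≤ (toℕ<n (c′ (suc j))))
    (+-cancelˡ-≡ (suc n) _ _ (+-cancelˡ-≡ (suc (toℕ j)) _ _ (begin
      suc (toℕ j) + (suc n + (suc n ∸ toℕ (c (suc j))))   ≡⟨ meetCount-vB c (suc j) ⟨
      meetCount (layout c) (vB (suc j))                   ≡⟨ meetCount-σ (vB (suc j)) ⟨
      meetCount (layout c′) (σ (vB (suc j)))              ≡⟨ cong (meetCount (layout c′)) (σ-fixes-vB j) ⟩
      meetCount (layout c′) (vB (suc j))                  ≡⟨ meetCount-vB c′ (suc j) ⟩
      suc (toℕ j) + (suc n + (suc n ∸ toℕ (c′ (suc j))))  ∎))))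
    where open ≡-Reasoning

funToFin-cong : ∀ {m n} {f g : Fin m → Fin n} → (∀ x → f x ≡ g x) → funToFin f ≡ funToFin g
funToFin-cong {zero}  _   = refl
funToFin-cong {suc m} f≗g = cong₂ combine (f≗g zero) (funToFin-cong (f≗g ∘ suc))

finToFun-injective : ∀ {m n} {i j : Fin (m ^ n)} → (∀ x → finToFun i x ≡ finToFun j x) → i ≡ j
finToFun-injective {m} {n} {i} {j} i≗j =
  trans (sym (funToFin-finToFin {n} {m} i)) (trans (funToFin-cong {n} {m} i≗j) (funToFin-finToFin {n} {m} j))

intervalClasses : ∀ n → AtLeastIntervalClasses (3 * suc n) (suc n ^ n)
intervalClasses n = graph ∘ code , graph-isInterval ∘ code ,
                    λ i j iso → finToFun-injective (≅⇒tails-agree {c = code i} {c′ = code j} refl iso)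
  where
  code : Fin (suc n ^ n) → Fin (suc n) → Fin (suc n)
  code i = zero ∷ finToFun i

mainTheorem1 : ∀ (k : ℕ) → ∃[ m ] ((k ! ≤ (3 ^ (3 * k)) * m) × AtLeastIntervalClasses (3 * k) m)
mainTheorem1 zero    = 1 , ≤-refl , (λ _ → graph {0} (λ ())) , (λ _ → graph-isInterval {0} (λ ())) ,
                       λ { zero zero _ → refl }
mainTheorem1 (suc n) = suc n ^ n , factorial-bound n , intervalClasses n
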